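{- Let $(G,\sigma)$ be a connected signed graph with a fixed orientation $\tau$. If $(G,\sigma)$ admits a modulo $2$-flow $f_1$ such that $\mathrm{supp}(f_1)$ contains an even number of negative edges, then $(G,\sigma)$ also admits an integer-valued $3$-flow $f_2$ with $\mathrm{supp}(f_1)=\{e\in E(G)\colon f_2(e)=\pm 1\}$.
   Context: Graphs may have multiple edges and loops. A signed graph $(G,\sigma)$ is a graph $G$ with a signature $\sigma\colon E(G)\to\{\pm1\}$; an edge $e$ is positive if $\sigma(e)=1$ and negative otherwise. Each edge consists of two half-edges, each incident with exactly one end of the edge; $H(v)$ denotes the set of half-edges incident with $v$, $H(G)=\bigcup_v H(v)$, and $e_h$ is the edge containing half-edge $h$. An orientation of $(G,\sigma)$ is a map $\tau\colon H(G)\to\{\pm1\}$ with $\tau(h_1)\tau(h_2)=-\sigma(e)$ for every edge $e$ with half-edges $h_1,h_2$. For a positive integer $k$ and a map $f\colon E(G)\to\mathbb{Z}$ with $0\le |f(e)|\le k-1$ for all $e$, the boundary of $f$ at $v$ is $\partial f(v)=\sum_{h\in H(v)} f(e_h)\tau(h)$. Such $f$ is an integer-valued $k$-flow if $\partial f(v)=0$ for all $v$, and a modulo $k$-flow if $\partial f(v)\equiv 0\pmod k$ for all $v$. The support is $\mathrm{supp}(f)=\{e\colon f(e)\neq 0\}$. -}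

module Defs where

open import Data.Nat as ℕ using (ℕ; zero; suc)
open import Data.Integer as ℤ using (ℤ; +_; -_; ∣_∣)
open import Data.Fin using (Fin; zero; suc)
open import Data.Fin.Properties using (_≟_)
open import Data.Sign as Sign using (Sign)
open import Data.Product using (Σ; _×_; ∃-syntax)
open import Data.Sum using (_⊎_)
open import Relation.Binary.PropositionalEquality using (_≡_)
open import Relation.Nullary using (¬_; Dec; yes; no)
open import Relation.Nullary.Decidable using (⌊_⌋)
import Data.Nat.Divisibility as ℕDiv
import Data.Integer.Divisibility as ℤDiv

-- Edge e has two half-edges (e , 0) and (e , 1);
-- half-edge (e , s) is incident with the vertex  end e s.
record SignedGraph : Set where
  field
    n   : ℕ
    m   : ℕ
    end : Fin m → Fin 2 → Fin n
    σ   : Fin m → Sign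

  Vertex : Set
  Vertex = Fin n

  Edge : Set
  Edge = Fin m

open SignedGraph public

⟦_⟧ : Sign → ℤ
⟦ Sign.+ ⟧ = + 1
⟦ Sign.- ⟧ = - (+ 1)

record Orientation (G : SignedGraph) : Set where
  field
    τ      : Edge G → Fin 2 → Sign
    τ-prop : ∀ e → τ e zero Sign.* τ e (suc zero) ≡ Sign.opposite (σ G e)

open Orientation public

∑ℤ : (k : ℕ) → (Fin k → ℤ) → ℤ
∑ℤ zero    g = + 0
∑ℤ (suc k) g = g zero ℤ.+ ∑ℤ k (λ i → g (suc i))

∑ℕ : (k : ℕ) → (Fin k → ℕ) → ℕ
∑ℕ zero    g = 0
∑ℕ (suc k) g = g zero ℕ.+ ∑ℕ k (λ i → g (suc i))

halfContribution : (G : SignedGraph) → Orientation G → (Edge G → ℤ) →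
                   Vertex G → Edge G → Fin 2 → ℤ
halfContribution G O f v e s with end G e s ≟ v
... | yes _ = f e ℤ.* ⟦ τ O e s ⟧
... | no  _ = + 0

∂ : (G : SignedGraph) → Orientation G → (Edge G → ℤ) → Vertex G → ℤ
∂ G O f v = ∑ℤ (m G) (λ e → ∑ℤ 2 (halfContribution G O f v e))

IntegerFlow : (G : SignedGraph) → Orientation G → ℕ → (Edge G → ℤ) → Set
IntegerFlow G O k f =
  (∀ e → ∣ f e ∣ ℕ.< k) × (∀ v → ∂ G O f v ≡ + 0)

ModuloFlow : (G : SignedGraph) → Orientation G → ℕ → (Edge G → ℤ) → Set
ModuloFlow G O k f =
  (∀ e → ∣ f e ∣ ℕ.< k) × (∀ v → (+ k) ℤDiv.∣ ∂ G O f v)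

InSupp : {G : SignedGraph} → (Edge G → ℤ) → Edge G → Set
InSupp f e = ¬ (f e ≡ + 0)

negInSupp : (G : SignedGraph) → (Edge G → ℤ) → ℕ
negInSupp G f = ∑ℕ (m G) (λ e → indicator e)
  where
  indicator : Edge G → ℕ
  indicator e with f e ℤ.≟ + 0 | σ G e
  ... | no _  | Sign.- = 1
  ... | _     | _      = 0

other : Fin 2 → Fin 2
other zero = suc zero
other (suc _) = zero

data Reach (G : SignedGraph) (u : Vertex G) : Vertex G → Set where
  here : Reach G u u
  step : ∀ {v} (e : Edge G) (s : Fin 2) →
         Reach G u v → end G e s ≡ v → Reach G u (end G e (other s))

Connected : SignedGraph → Set
Connected G = ∀ u v → Reach G u v

-- Let S = supp f₁. As f₁ is a modulo 2-flow, every vertex meets an even number of half-edges of S.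
-- Generalise to a set D of vertices: look for f₂, ±1 on S and 0 or ±2 elsewhere, with |∂f₂| = 2 on D
-- and 0 off D. This is possible as soon as every union X of connected components contains an even
-- number of vertices of D and negative edges of S, and we prove it by induction on the number of edges.
-- An edge outside S is deleted (value 0) unless that breaks the condition; then its ends are separated
-- and it takes ±2, toggling D at both ends. A loop in S takes ±1, toggling D at its vertex when it is
-- negative. Otherwise an edge of S at a has a second edge of S at a (by evenness); the two are merged
-- into one edge whose value ±1 is split so that it cancels at a, or, if the merged graph violates the
-- condition, adds up to ±2 at a while D is toggled at a. A wrong sign at a vertex is repaired by
-- negating f₂ on a union of components containing it but not the other end of the edge. For connected
-- G and D = ∅ the condition is exactly the hypothesis on negative edges.

module Submission where

open import Defs
open import Algebra.Bundles using (CommutativeRing)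
open import Data.Bool using (Bool; true; false; not; _∧_; _xor_; if_then_else_)
open import Data.Bool.Properties as Bool
  using (xor-∧-commutativeRing; ∧-zeroʳ; ∧-comm; ∧-distribʳ-xor; xor-same; xor-identityʳ; xor-comm)
open import Data.Empty using (⊥-elim)
open import Data.Fin using (Fin; zero; suc)
open import Data.Fin.Properties using (_≟_)
open import Data.Fin.Subset.Properties using (anySubset?)
open import Data.Integer as ℤ using (ℤ; +_; -_; -[1+_]; ∣_∣; _+_; _*_)
import Data.Integer.Properties as ℤ
import Data.Integer.Divisibility as ℤ∣ᵘ
import Data.Integer.Divisibility.Signed as ℤ∣
import Data.Integer.Tactic.RingSolver as ℤ-Solver
open import Data.List using (List; []; _∷_; _++_; length; tabulate)
open import Data.List.Properties using (length-tabulate)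
open import Data.List.Relation.Unary.All as All using (All; []; _∷_)
open import Data.List.Relation.Unary.All.Properties using (tabulate⁻)
open import Data.Maybe using (just; nothing)
open import Data.Nat as ℕ using (ℕ; zero; suc)
import Data.Nat.Properties as ℕ
open import Data.Nat.Divisibility as ℕ∣ using (_∣_)
open import Data.Product using (Σ; _×_; _,_; proj₁; proj₂)
open import Data.Sign as Sign using (Sign)
open import Data.Sum using (_⊎_; inj₁; inj₂)
open import Data.Vec using (lookup) renaming (tabulate to tabulateᵛ)
open import Data.Vec.Properties using (lookup∘tabulate)
open import Function.Bundles using (_⇔_; mk⇔)
import Function.Properties.Equivalence as ⇔
open import Relation.Binary.PropositionalEquality
  using (_≡_; _≢_; refl; sym; trans; cong; cong₂; subst; subst₂; _≗_; module ≡-Reasoning)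
open import Relation.Nullary using (¬_; Dec; yes; no; does)
open import Relation.Nullary.Decidable using (dec-true; dec-false; _×-dec_)
open import Tactic.RingSolver using (solve-∀)
open import Tactic.RingSolver.Core.AlmostCommutativeRing using (AlmostCommutativeRing; fromCommutativeRing)

xorRing : AlmostCommutativeRing _ _
xorRing = fromCommutativeRing xor-∧-commutativeRing λ { false → just refl ; true → nothing }

open import Algebra.Properties.Semiring.Sum (CommutativeRing.semiring xor-∧-commutativeRing)
  using (∑-distrib-+; sum-cong-≗; sum-replicate-zero; *-distribˡ-sum)
  renaming (sum to parity)

xor-swap : ∀ a b c → a xor (b xor c) ≡ b xor (a xor c)
xor-swap = solve-∀ xorRing

xor-interchange : ∀ a b c d → (a xor b) xor (c xor d) ≡ (a xor c) xor (b xor d)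
xor-interchange = solve-∀ xorRing

xor≡false⇒≡ : ∀ {x y} → x xor y ≡ false → x ≡ y
xor≡false⇒≡ {false} {false} _ = refl
xor≡false⇒≡ {true}  {true}  _ = refl

xor-true⇒≡true : ∀ {x} → x xor true ≡ false → x ≡ true
xor-true⇒≡true {true} _ = refl

δ : ∀ {k} → Fin k → Fin k → Bool
δ v w = does (v ≟ w)

parity-δ : ∀ {k} (v : Fin k) (X : Fin k → Bool) → parity (λ w → δ v w ∧ X w) ≡ X v
parity-δ {suc k} zero    X = trans (cong (X zero xor_) (sum-replicate-zero k)) (xor-identityʳ (X zero))
parity-δ {suc k} (suc v) X = parity-δ v (λ w → X (suc w))

parity-∧-constant : ∀ {k} (c t : Fin k → Bool) → (∀ i j → c i ≡ c j) →
                    parity t ≡ false → parity (λ i → c i ∧ t i) ≡ false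
parity-∧-constant {zero}  c t _ _ = refl
parity-∧-constant {suc k} c t constant even = begin
  parity (λ i → c i ∧ t i)      ≡⟨ sum-cong-≗ (λ i → cong (_∧ t i) (constant i zero)) ⟩
  parity (λ i → c zero ∧ t i)   ≡⟨ sym (*-distribˡ-sum (c zero) t) ⟩
  c zero ∧ parity t             ≡⟨ cong (c zero ∧_) even ⟩
  c zero ∧ false                ≡⟨ ∧-zeroʳ (c zero) ⟩
  false                         ∎
  where open ≡-Reasoning

bit : Bool → ℕ
bit false = 0
bit true  = 1

count≡parity+even : ∀ k (t : Fin k → Bool) →
                    Σ ℕ λ q → ∑ℕ k (λ i → bit (t i)) ≡ bit (parity t) ℕ.+ 2 ℕ.* q
count≡parity+even zero    t = 0 , refl
count≡parity+even (suc k) t with t zero | parity (λ i → t (suc i)) | count≡parity+even k (λ i → t (suc i))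
... | false | _     | q , eq = q , eq
... | true  | false | q , eq = q , cong suc eq
... | true  | true  | q , eq = suc q , trans (cong suc eq) (sym (ℕ.*-suc 2 q))

even-count⇒parity-false : ∀ k (t : Fin k → Bool) → 2 ∣ ∑ℕ k (λ i → bit (t i)) → parity t ≡ false
even-count⇒parity-false k t even with parity t | count≡parity+even k t
... | false | _      = refl
... | true  | q , eq = ⊥-elim (2∤1 (ℕ∣.∣m+n∣m⇒∣n (subst (2 ∣_) (trans eq (ℕ.+-comm 1 (2 ℕ.* q))) even) (ℕ∣.m∣m*n q)))
  where
  2∤1 : ¬ (2 ∣ 1)
  2∤1 d with ℕ∣.∣1⇒≡1 d
  ... | ()

twice : Sign → ℤ
twice s = ⟦ s ⟧ + ⟦ s ⟧

demand : Bool → ℕ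
demand d = if d then 2 else 0

sameSign : Sign → Sign → Bool
sameSign Sign.+ Sign.+ = true
sameSign Sign.- Sign.- = true
sameSign _      _      = false

sameSign-comm : ∀ s t → sameSign s t ≡ sameSign t s
sameSign-comm Sign.+ Sign.+ = refl
sameSign-comm Sign.+ Sign.- = refl
sameSign-comm Sign.- Sign.+ = refl
sameSign-comm Sign.- Sign.- = refl

twice-* : ∀ s t → twice s * ⟦ t ⟧ ≡ twice (s Sign.* t)
twice-* Sign.+ Sign.+ = refl
twice-* Sign.+ Sign.- = refl
twice-* Sign.- Sign.+ = refl
twice-* Sign.- Sign.- = refl

twice-*-cancel : ∀ s t → twice (s Sign.* t) * ⟦ t ⟧ ≡ twice s
twice-*-cancel Sign.+ Sign.+ = refl
twice-*-cancel Sign.+ Sign.- = refl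
twice-*-cancel Sign.- Sign.+ = refl
twice-*-cancel Sign.- Sign.- = refl

∣twice∣ : ∀ s → ∣ twice s ∣ ≡ 2
∣twice∣ Sign.+ = refl
∣twice∣ Sign.- = refl

positive-loop : ∀ t₀ t₁ → sameSign t₀ t₁ ≡ false → ⟦ Sign.+ ⟧ * ⟦ t₀ ⟧ + ⟦ Sign.+ ⟧ * ⟦ t₁ ⟧ ≡ + 0
positive-loop Sign.+ Sign.- _ = refl
positive-loop Sign.- Sign.+ _ = refl

negative-loop : ∀ s t₀ t₁ → sameSign t₀ t₁ ≡ true → ⟦ s Sign.* t₀ ⟧ * ⟦ t₀ ⟧ + ⟦ s Sign.* t₀ ⟧ * ⟦ t₁ ⟧ ≡ twice s
negative-loop Sign.+ Sign.+ Sign.+ _ = refl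
negative-loop Sign.+ Sign.- Sign.- _ = refl
negative-loop Sign.- Sign.+ Sign.+ _ = refl
negative-loop Sign.- Sign.- Sign.- _ = refl

sameSign-merge : ∀ p₁ q₁ p₂ q₂ → sameSign q₁ (Sign.opposite (p₁ Sign.* p₂) Sign.* q₂) ≡ sameSign p₁ q₁ xor sameSign p₂ q₂
sameSign-merge Sign.+ Sign.+ Sign.+ Sign.+ = refl
sameSign-merge Sign.+ Sign.+ Sign.+ Sign.- = refl
sameSign-merge Sign.+ Sign.+ Sign.- Sign.+ = refl
sameSign-merge Sign.+ Sign.+ Sign.- Sign.- = refl
sameSign-merge Sign.+ Sign.- Sign.+ Sign.+ = refl
sameSign-merge Sign.+ Sign.- Sign.+ Sign.- = refl
sameSign-merge Sign.+ Sign.- Sign.- Sign.+ = refl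
sameSign-merge Sign.+ Sign.- Sign.- Sign.- = refl
sameSign-merge Sign.- Sign.+ Sign.+ Sign.+ = refl
sameSign-merge Sign.- Sign.+ Sign.+ Sign.- = refl
sameSign-merge Sign.- Sign.+ Sign.- Sign.+ = refl
sameSign-merge Sign.- Sign.+ Sign.- Sign.- = refl
sameSign-merge Sign.- Sign.- Sign.+ Sign.+ = refl
sameSign-merge Sign.- Sign.- Sign.+ Sign.- = refl
sameSign-merge Sign.- Sign.- Sign.- Sign.+ = refl
sameSign-merge Sign.- Sign.- Sign.- Sign.- = refl

sameSign-opposite : ∀ q s t → sameSign q (Sign.opposite s Sign.* t) ≡ not (sameSign q (s Sign.* t))
sameSign-opposite Sign.+ Sign.+ Sign.+ = refl
sameSign-opposite Sign.+ Sign.+ Sign.- = refl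
sameSign-opposite Sign.+ Sign.- Sign.+ = refl
sameSign-opposite Sign.+ Sign.- Sign.- = refl
sameSign-opposite Sign.- Sign.+ Sign.+ = refl
sameSign-opposite Sign.- Sign.+ Sign.- = refl
sameSign-opposite Sign.- Sign.- Sign.+ = refl
sameSign-opposite Sign.- Sign.- Sign.- = refl

⟦⟧-shift : ∀ ε s t → ⟦ ε Sign.* s ⟧ * ⟦ t ⟧ ≡ ⟦ s ⟧ * ⟦ ε Sign.* t ⟧
⟦⟧-shift Sign.+ Sign.+ Sign.+ = refl
⟦⟧-shift Sign.+ Sign.+ Sign.- = refl
⟦⟧-shift Sign.+ Sign.- Sign.+ = refl
⟦⟧-shift Sign.+ Sign.- Sign.- = refl
⟦⟧-shift Sign.- Sign.+ Sign.+ = refl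
⟦⟧-shift Sign.- Sign.+ Sign.- = refl
⟦⟧-shift Sign.- Sign.- Sign.+ = refl
⟦⟧-shift Sign.- Sign.- Sign.- = refl

merge-cancels : ∀ s p₁ p₂ → ⟦ s ⟧ * ⟦ p₁ ⟧ + ⟦ Sign.opposite (p₁ Sign.* p₂) Sign.* s ⟧ * ⟦ p₂ ⟧ ≡ + 0
merge-cancels Sign.+ Sign.+ Sign.+ = refl
merge-cancels Sign.+ Sign.+ Sign.- = refl
merge-cancels Sign.+ Sign.- Sign.+ = refl
merge-cancels Sign.+ Sign.- Sign.- = refl
merge-cancels Sign.- Sign.+ Sign.+ = refl
merge-cancels Sign.- Sign.+ Sign.- = refl
merge-cancels Sign.- Sign.- Sign.+ = refl
merge-cancels Sign.- Sign.- Sign.- = refl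

merge-doubles : ∀ s p₁ p₂ → ⟦ s ⟧ * ⟦ p₁ ⟧ + ⟦ (p₁ Sign.* p₂) Sign.* s ⟧ * ⟦ p₂ ⟧ ≡ twice (s Sign.* p₁)
merge-doubles Sign.+ Sign.+ Sign.+ = refl
merge-doubles Sign.+ Sign.+ Sign.- = refl
merge-doubles Sign.+ Sign.- Sign.+ = refl
merge-doubles Sign.+ Sign.- Sign.- = refl
merge-doubles Sign.- Sign.+ Sign.+ = refl
merge-doubles Sign.- Sign.+ Sign.- = refl
merge-doubles Sign.- Sign.- Sign.+ = refl
merge-doubles Sign.- Sign.- Sign.- = refl

data Demanded : Bool → ℤ → Set where
  none : Demanded false (+ 0)
  ±2   : ∀ s → Demanded true (twice s)

demanded : ∀ d β → ∣ β ∣ ≡ demand d → Demanded d β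
demanded false (+ 0)                 _ = none
demanded true  (+ 2)                 _ = ±2 Sign.+
demanded true  -[1+ 1 ]              _ = ±2 Sign.-
demanded false (+ suc _)             ()
demanded false -[1+ _ ]              ()
demanded true  (+ 0)                 ()
demanded true  (+ 1)                 ()
demanded true  (+ suc (suc (suc _))) ()
demanded true  -[1+ 0 ]              ()
demanded true  -[1+ suc (suc _) ]    ()

-- A ±2 repairs a vertex whose demand was toggled: with a free sign, or with a fixed sign up to negating the rest.
absorb : ∀ d β → ∣ β ∣ ≡ demand (not d) → Σ Sign λ s → ∣ twice s + β ∣ ≡ demand d
absorb d β ∣β∣ with d | demanded (not d) β ∣β∣
... | true  | none         = Sign.+ , refl
... | false | ±2 Sign.+    = Sign.- , refl
... | false | ±2 Sign.-    = Sign.+ , refl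

absorb-up-to-sign : ∀ d β s → ∣ β ∣ ≡ demand (not d) → ∣ twice s + β ∣ ≡ demand d ⊎ ∣ twice s + - β ∣ ≡ demand d
absorb-up-to-sign d β s ∣β∣ with d | demanded (not d) β ∣β∣ | s
... | true  | none      | t      = inj₁ (trans (cong ∣_∣ (ℤ.+-identityʳ (twice t))) (∣twice∣ t))
... | false | ±2 Sign.+ | Sign.+ = inj₂ refl
... | false | ±2 Sign.+ | Sign.- = inj₁ refl
... | false | ±2 Sign.- | Sign.+ = inj₁ refl
... | false | ±2 Sign.- | Sign.- = inj₂ refl

negIf : Bool → ℤ → ℤ
negIf b z = if b then - z else z

negIf-0 : ∀ b → negIf b (+ 0) ≡ + 0
negIf-0 false = refl
negIf-0 true  = refl

∣negIf∣ : ∀ b z → ∣ negIf b z ∣ ≡ ∣ z ∣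
∣negIf∣ false z = refl
∣negIf∣ true  z = ℤ.∣-i∣≡∣i∣ z

data Weight : Bool → ℤ → Set where
  ±1   : ∀ s → Weight true ⟦ s ⟧
  none : Weight false (+ 0)
  ±2   : ∀ s → Weight false (twice s)

negateWeight : ∀ {b y} → Weight b y → Weight b (- y)
negateWeight (±1 Sign.+) = ±1 Sign.-
negateWeight (±1 Sign.-) = ±1 Sign.+
negateWeight none        = none
negateWeight (±2 Sign.+) = ±2 Sign.-
negateWeight (±2 Sign.-) = ±2 Sign.+

All-insert : {A : Set} {P : A → Set} (pre : List A) {post : List A} {x : A} →
             All P (pre ++ post) → P x → All P (pre ++ x ∷ post)
All-insert []        ps       px = px ∷ ps
All-insert (_ ∷ pre) (p ∷ ps) px = p ∷ All-insert pre ps px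

length-insert : {A : Set} (pre : List A) (x : A) (post : List A) → length (pre ++ x ∷ post) ≡ suc (length (pre ++ post))
length-insert []        x post = refl
length-insert (_ ∷ pre) x post = cong suc (length-insert pre x post)

xorOver : {A : Set} → (A → Bool) → List A → Bool
xorOver f []       = false
xorOver f (x ∷ xs) = f x xor xorOver f xs

xorOver-mid : {A : Set} (f : A → Bool) (pre : List A) (x : A) (post : List A) →
              xorOver f (pre ++ x ∷ post) ≡ f x xor xorOver f (pre ++ post)
xorOver-mid f []        x post = refl
xorOver-mid f (y ∷ pre) x post =
  trans (cong (f y xor_) (xorOver-mid f pre x post)) (xor-swap (f y) (f x) (xorOver f (pre ++ post)))

xorOver-∧-xor : {A : Set} (c f g : A → Bool) (xs : List A) →
                xorOver (λ a → c a ∧ (f a xor g a)) xs ≡ xorOver (λ a → c a ∧ f a) xs xor xorOver (λ a → c a ∧ g a) xs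
xorOver-∧-xor c f g []       = refl
xorOver-∧-xor c f g (x ∷ xs) =
  trans (cong (c x ∧ (f x xor g x) xor_) (xorOver-∧-xor c f g xs)) (distrib (c x) (f x) (g x) _ _)
  where
  distrib : ∀ c f g r s → (c ∧ (f xor g)) xor (r xor s) ≡ ((c ∧ f) xor r) xor ((c ∧ g) xor s)
  distrib = solve-∀ xorRing

xorOver-cong : {A : Set} {f g : A → Bool} → f ≗ g → ∀ xs → xorOver f xs ≡ xorOver g xs
xorOver-cong f≗g []       = refl
xorOver-cong f≗g (x ∷ xs) = cong₂ _xor_ (f≗g x) (xorOver-cong f≗g xs)

xorOver-tabulate : {A : Set} (f : A → Bool) {k : ℕ} (g : Fin k → A) → xorOver f (tabulate g) ≡ parity (λ i → f (g i))
xorOver-tabulate f {zero}  g = refl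
xorOver-tabulate f {suc k} g = cong (f (g zero) xor_) (xorOver-tabulate f (λ i → g (suc i)))

-- Systems of arcs

module Arcs (n : ℕ) where

  VertexSet : Set
  VertexSet = Fin n → Bool

  record Arc : Set where
    constructor arc
    field
      end₀ end₁ : Fin n
      τ₀ τ₁     : Sign
      odd       : Bool
  open Arc public

  at : Fin n → ℤ → Fin n → ℤ
  at v z w = if δ v w then z else + 0

  flowAt : Arc → ℤ → Fin n → ℤ
  flowAt e y w = at (end₀ e) (y * ⟦ τ₀ e ⟧) w + at (end₁ e) (y * ⟦ τ₁ e ⟧) w

  record Weighted (e : Arc) : Set where
    constructor weighted
    field
      value  : ℤ
      weight : Weight (odd e) value
  open Weighted public

  boundary : ∀ {es} → All Weighted es → Fin n → ℤ
  boundary []                     w = + 0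
  boundary {e ∷ _} (weighted y _ ∷ W) w = flowAt e y w + boundary W w

  Realisation : List Arc → VertexSet → Set
  Realisation es D = Σ (All Weighted es) λ W → ∀ w → ∣ boundary W w ∣ ≡ demand (D w)

  arcDegree : Arc → Fin n → Bool
  arcDegree e w = odd e ∧ (δ (end₀ e) w xor δ (end₁ e) w)

  EvenDegrees : List Arc → Set
  EvenDegrees es = ∀ w → xorOver (λ e → arcDegree e w) es ≡ false

  oddNegative : Arc → Bool
  oddNegative e = odd e ∧ sameSign (τ₀ e) (τ₁ e)

  Closed : List Arc → VertexSet → Set
  Closed es X = All (λ e → X (end₀ e) ≡ X (end₁ e)) es

  imbalance : List Arc → VertexSet → VertexSet → Bool
  imbalance es D X = parity (λ w → D w ∧ X w) xor xorOver (λ e → oddNegative e ∧ X (end₀ e)) es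

  -- Necessary for realising D: summed over a closed X the boundary gets ±2y from each negative arc and 0 from the others.
  Feasible : List Arc → VertexSet → Set
  Feasible es D = ∀ X → Closed es X → imbalance es D X ≡ false

  _⊕_ : VertexSet → VertexSet → VertexSet
  (X ⊕ Y) w = X w xor Y w

  toggle : Fin n → VertexSet → VertexSet
  toggle v D w = δ v w xor D w

  toggle-here : ∀ v D → toggle v D v ≡ not (D v)
  toggle-here v D rewrite dec-true (v ≟ v) refl = refl

  toggle-elsewhere : ∀ {v w} D → v ≢ w → toggle v D w ≡ D w
  toggle-elsewhere {v} {w} D v≢w rewrite dec-false (v ≟ w) v≢w = refl

  imbalance-⊕ : ∀ es D X Y → imbalance es D (X ⊕ Y) ≡ imbalance es D X xor imbalance es D Y
  imbalance-⊕ es D X Y =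
    trans (cong₂ _xor_ demands (xorOver-∧-xor oddNegative (λ e → X (end₀ e)) (λ e → Y (end₀ e)) es))
          (xor-interchange (parity (λ w → D w ∧ X w)) (parity (λ w → D w ∧ Y w))
                       (xorOver (λ e → oddNegative e ∧ X (end₀ e)) es) (xorOver (λ e → oddNegative e ∧ Y (end₀ e)) es))
    where
    demands : parity (λ w → D w ∧ (X w xor Y w)) ≡ parity (λ w → D w ∧ X w) xor parity (λ w → D w ∧ Y w)
    demands = trans (sum-cong-≗ (λ w → Bool.∧-distribˡ-xor (D w) (X w) (Y w)))
                    (∑-distrib-+ (λ w → D w ∧ X w) (λ w → D w ∧ Y w))

  imbalance-toggle : ∀ es v D X → imbalance es (toggle v D) X ≡ X v xor imbalance es D X
  imbalance-toggle es v D X =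
    trans (cong (_xor xorOver (λ e → oddNegative e ∧ X (end₀ e)) es) demands)
          (Bool.xor-assoc (X v) (parity (λ w → D w ∧ X w)) (xorOver (λ e → oddNegative e ∧ X (end₀ e)) es))
    where
    demands : parity (λ w → (δ v w xor D w) ∧ X w) ≡ X v xor parity (λ w → D w ∧ X w)
    demands = trans (sum-cong-≗ (λ w → ∧-distribʳ-xor (X w) (δ v w) (D w)))
                    (trans (∑-distrib-+ (λ w → δ v w ∧ X w) (λ w → D w ∧ X w))
                           (cong (_xor parity (λ w → D w ∧ X w)) (parity-δ v X)))

  Closed-⊕ : ∀ {es X Y} → Closed es X → Closed es Y → Closed es (X ⊕ Y)
  Closed-⊕ clX clY = All.zipWith (λ (p , q) → cong₂ _xor_ p q) (clX , clY)

  Closed-complement : ∀ {es X} → Closed es X → Closed es (λ w → not (X w))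
  Closed-complement = All.map (cong not)

  feasible-[]⇒no-demand : ∀ D → Feasible [] D → ∀ w → D w ≡ false
  feasible-[]⇒no-demand D feasible w = begin
    D w                                              ≡⟨ sym (parity-δ w D) ⟩
    parity (λ v → δ w v ∧ D v)                       ≡⟨ sum-cong-≗ (λ v → ∧-comm (δ w v) (D v)) ⟩
    parity (λ v → D v ∧ δ w v)                       ≡⟨ sym (xor-identityʳ _) ⟩
    imbalance [] D (δ w)                             ≡⟨ feasible (δ w) [] ⟩
    false                                            ∎
    where open ≡-Reasoning

  Closed-cong : ∀ {es X Y} → X ≗ Y → Closed es X → Closed es Y
  Closed-cong X≗Y = All.map (λ p → trans (sym (X≗Y _)) (trans p (X≗Y _)))

  imbalance-cong : ∀ es D {X Y} → X ≗ Y → imbalance es D X ≡ imbalance es D Y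
  imbalance-cong es D X≗Y =
    cong₂ _xor_ (sum-cong-≗ (λ w → cong (D w ∧_) (X≗Y w))) (xorOver-cong (λ e → cong (oddNegative e ∧_) (X≗Y (end₀ e))) es)

  Unbalanced : List Arc → VertexSet → Set
  Unbalanced es D = Σ VertexSet λ X → Closed es X × imbalance es D X ≡ true

  feasible? : ∀ es D → Feasible es D ⊎ Unbalanced es D
  feasible? es D with anySubset? {P = λ V → Closed es (lookup V) × imbalance es D (lookup V) ≡ true}
                        (λ V → All.all? (λ e → lookup V (end₀ e) Bool.≟ lookup V (end₁ e)) es
                               ×-dec (imbalance es D (lookup V) Bool.≟ true))
  ... | yes (V , unbalanced) = inj₂ (lookup V , unbalanced)
  ... | no balanced          = inj₁ feasible
    where
    feasible : Feasible es D
    feasible X closed with imbalance es D X in eq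
    ... | false = refl
    ... | true  = ⊥-elim (balanced (tabulateᵛ X , Closed-cong X≗ closed , trans (sym (imbalance-cong es D X≗)) eq))
      where
      X≗ : X ≗ lookup (tabulateᵛ X)
      X≗ w = sym (lookup∘tabulate X w)

  imbalance-separating : ∀ {es D a b X₀} → Closed es X₀ → imbalance es D X₀ ≡ true →
                         (∀ Y → Closed es Y → Y a ≡ Y b → imbalance es D Y ≡ false) →
                         ∀ Y → Closed es Y → imbalance es D Y ≡ (Y a xor Y b)
  imbalance-separating {es} {D} {a} {b} {X₀} closed₀ unbalanced₀ balanced Y closedY with Y a xor Y b in sepY
  ... | false = balanced Y closedY (xor≡false⇒≡ sepY)
  ... | true  = xor-true⇒≡true (begin
    imbalance es D Y xor true               ≡⟨ cong (imbalance es D Y xor_) unbalanced₀ ⟨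
    imbalance es D Y xor imbalance es D X₀  ≡⟨ imbalance-⊕ es D Y X₀ ⟨
    imbalance es D (Y ⊕ X₀)                 ≡⟨ balanced (Y ⊕ X₀) (Closed-⊕ closedY closed₀) (xor≡false⇒≡ sepZ) ⟩
    false                                   ∎)
    where
    open ≡-Reasoning
    sep₀ : X₀ a xor X₀ b ≡ true
    sep₀ with X₀ a xor X₀ b in eq
    ... | true  = refl
    ... | false with trans (sym unbalanced₀) (balanced X₀ closed₀ (xor≡false⇒≡ eq))
    ...   | ()
    sepZ : (Y a xor X₀ a) xor (Y b xor X₀ b) ≡ false
    sepZ = trans (xor-interchange (Y a) (X₀ a) (Y b) (X₀ b)) (cong₂ _xor_ sepY sep₀)

  separator : ∀ {es X a b} → Closed es X → X a xor X b ≡ true →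
              Σ VertexSet λ K → Closed es K × K a ≡ true × K b ≡ false
  separator {X = X} {a} {b} closed sep with X a in xa | X b in xb
  ... | true  | false = X , closed , xa , xb
  ... | false | true  = (λ w → not (X w)) , Closed-complement closed , cong not xa , cong not xb
  separator closed () | true  | true
  separator closed () | false | false

  at-here : ∀ v z → at v z v ≡ z
  at-here v z = cong (λ b → if b then z else + 0) (dec-true (v ≟ v) refl)

  at-elsewhere : ∀ {v w} z → v ≢ w → at v z w ≡ + 0
  at-elsewhere {v} {w} z v≢w = cong (λ b → if b then z else + 0) (dec-false (v ≟ w) v≢w)

  at-+ : ∀ v z z′ w → at v z w + at v z′ w ≡ at v (z + z′) w
  at-+ v z z′ w = by-cases (δ v w)
    where
    by-cases : ∀ b → (if b then z else + 0) + (if b then z′ else + 0) ≡ (if b then z + z′ else + 0)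
    by-cases true  = refl
    by-cases false = refl

  at-neg : ∀ v z w → at v (- z) w ≡ - at v z w
  at-neg v z w = by-cases (δ v w)
    where
    by-cases : ∀ b → (if b then - z else + 0) ≡ - (if b then z else + 0)
    by-cases true  = refl
    by-cases false = refl

  at-0 : ∀ v w → at v (+ 0) w ≡ + 0
  at-0 v w = by-cases (δ v w)
    where
    by-cases : ∀ b → (if b then + 0 else + 0) ≡ + 0
    by-cases true  = refl
    by-cases false = refl

  at-realises : ∀ v z (β : Fin n → ℤ) {w t} →
                (v ≡ w → ∣ z + β w ∣ ≡ t) → (v ≢ w → ∣ β w ∣ ≡ t) → ∣ at v z w + β w ∣ ≡ t
  at-realises v z β {w} on-v off-v with v ≟ w
  ... | yes v≡w = on-v v≡w
  ... | no  v≢w = trans (cong ∣_∣ (ℤ.+-identityˡ (β w))) (off-v v≢w)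

  flowAt-elsewhere : ∀ e y {w} → end₀ e ≢ w → end₁ e ≢ w → flowAt e y w ≡ + 0
  flowAt-elsewhere e y n₀ n₁ = cong₂ _+_ (at-elsewhere _ n₀) (at-elsewhere _ n₁)

  flowAt-negIf : ∀ k e y w → flowAt e (negIf k y) w ≡ negIf k (flowAt e y w)
  flowAt-negIf false e y w = refl
  flowAt-negIf true  e y w = begin
    at (end₀ e) (- y * ⟦ τ₀ e ⟧) w + at (end₁ e) (- y * ⟦ τ₁ e ⟧) w
      ≡⟨ cong₂ (λ z₀ z₁ → at (end₀ e) z₀ w + at (end₁ e) z₁ w)
               (ℤ.neg-distribˡ-* y ⟦ τ₀ e ⟧) (ℤ.neg-distribˡ-* y ⟦ τ₁ e ⟧) ⟨
    at (end₀ e) (- (y * ⟦ τ₀ e ⟧)) w + at (end₁ e) (- (y * ⟦ τ₁ e ⟧)) w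
      ≡⟨ cong₂ _+_ (at-neg (end₀ e) _ w) (at-neg (end₁ e) _ w) ⟩
    - at (end₀ e) (y * ⟦ τ₀ e ⟧) w + - at (end₁ e) (y * ⟦ τ₁ e ⟧) w
      ≡⟨ ℤ.neg-distrib-+ (at (end₀ e) (y * ⟦ τ₀ e ⟧) w) (at (end₁ e) (y * ⟦ τ₁ e ⟧) w) ⟨
    - flowAt e y w ∎
    where open ≡-Reasoning

  flowAt-negateOn : ∀ K e y w → K (end₀ e) ≡ K (end₁ e) →
                    flowAt e (negIf (K (end₀ e)) y) w ≡ negIf (K w) (flowAt e y w)
  flowAt-negateOn K e y w closed = by-cases (end₀ e ≟ w) (end₁ e ≟ w)
    where
    by-cases : Dec (end₀ e ≡ w) → Dec (end₁ e ≡ w) → flowAt e (negIf (K (end₀ e)) y) w ≡ negIf (K w) (flowAt e y w)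
    by-cases (yes e₀≡w) _ = subst (λ k → flowAt e (negIf k y) w ≡ negIf (K w) (flowAt e y w))
                                   (cong K (sym e₀≡w)) (flowAt-negIf (K w) e y w)
    by-cases (no _) (yes e₁≡w) = subst (λ k → flowAt e (negIf k y) w ≡ negIf (K w) (flowAt e y w))
                                   (trans (cong K (sym e₁≡w)) (sym closed)) (flowAt-negIf (K w) e y w)
    by-cases (no n₀) (no n₁) = begin
      flowAt e (negIf (K (end₀ e)) y) w  ≡⟨ flowAt-elsewhere e (negIf (K (end₀ e)) y) n₀ n₁ ⟩
      + 0                                ≡⟨ negIf-0 (K w) ⟨
      negIf (K w) (+ 0)                  ≡⟨ cong (negIf (K w)) (flowAt-elsewhere e y n₀ n₁) ⟨
      negIf (K w) (flowAt e y w)         ∎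
      where open ≡-Reasoning

  flowAt-realises : ∀ e y (β : Fin n → ℤ) {w t} → end₀ e ≢ end₁ e →
                    (end₀ e ≡ w → ∣ y * ⟦ τ₀ e ⟧ + β w ∣ ≡ t) → (end₁ e ≡ w → ∣ y * ⟦ τ₁ e ⟧ + β w ∣ ≡ t) →
                    (end₀ e ≢ w → end₁ e ≢ w → ∣ β w ∣ ≡ t) → ∣ flowAt e y w + β w ∣ ≡ t
  flowAt-realises e y β {w} e₀≢e₁ at₀ at₁ elsewhere =
    trans (cong ∣_∣ (ℤ.+-assoc (at (end₀ e) _ w) _ (β w)))
          (at-realises (end₀ e) (y * ⟦ τ₀ e ⟧) (λ v → at (end₁ e) (y * ⟦ τ₁ e ⟧) v + β v) at₀′
                       λ n₀ → at-realises (end₁ e) (y * ⟦ τ₁ e ⟧) β at₁ (elsewhere n₀))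
    where
    at₀′ : end₀ e ≡ w → ∣ y * ⟦ τ₀ e ⟧ + (at (end₁ e) (y * ⟦ τ₁ e ⟧) w + β w) ∣ ≡ _
    at₀′ refl = trans (cong (λ z → ∣ y * ⟦ τ₀ e ⟧ + (z + β w) ∣) (at-elsewhere _ (λ eq → e₀≢e₁ (sym eq))))
                      (trans (cong (λ z → ∣ y * ⟦ τ₀ e ⟧ + z ∣) (ℤ.+-identityˡ (β w))) (at₀ refl))

  negateIf : ∀ {e} → Bool → Weighted e → Weighted e
  negateIf false h       = h
  negateIf true  (weighted y u) = weighted (- y) (negateWeight u)

  negateOn : VertexSet → ∀ {es} → All Weighted es → All Weighted es
  negateOn K []               = []
  negateOn K {e ∷ _} (h ∷ W) = negateIf (K (end₀ e)) h ∷ negateOn K W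

  boundary-negateOn : ∀ K {es} → Closed es K → (W : All Weighted es) → ∀ w →
                      boundary (negateOn K W) w ≡ negIf (K w) (boundary W w)
  boundary-negateOn K []               []             w = sym (negIf-0 (K w))
  boundary-negateOn K {e ∷ es} (c ∷ cs) (weighted y u ∷ W) w = begin
    flowAt e (value (negateIf (K (end₀ e)) (weighted y u))) w + boundary (negateOn K W) w
      ≡⟨ cong₂ _+_ (cong (λ z → flowAt e z w) (negateIf-value (K (end₀ e)))) (boundary-negateOn K cs W w) ⟩
    flowAt e (negIf (K (end₀ e)) y) w + negIf (K w) (boundary W w)
      ≡⟨ cong (_+ negIf (K w) (boundary W w)) (flowAt-negateOn K e y w c) ⟩
    negIf (K w) (flowAt e y w) + negIf (K w) (boundary W w)
      ≡⟨ negIf-+ (K w) ⟨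
    negIf (K w) (flowAt e y w + boundary W w) ∎
    where
    open ≡-Reasoning
    negateIf-value : ∀ k → value (negateIf k (weighted y u)) ≡ negIf k y
    negateIf-value false = refl
    negateIf-value true  = refl
    negIf-+ : ∀ k → negIf k (flowAt e y w + boundary W w) ≡ negIf k (flowAt e y w) + negIf k (boundary W w)
    negIf-+ false = refl
    negIf-+ true  = ℤ.neg-distrib-+ (flowAt e y w) (boundary W w)

  boundary-negateOn-outside : ∀ K {es} → Closed es K → (W : All Weighted es) → ∀ {w} → K w ≡ false →
                              boundary (negateOn K W) w ≡ boundary W w
  boundary-negateOn-outside K closed W {w} K-w = trans (boundary-negateOn K closed W w) (cong (λ k → negIf k (boundary W w)) K-w)

  boundary-negateOn-inside : ∀ K {es} → Closed es K → (W : All Weighted es) → ∀ {w} → K w ≡ true →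
                             boundary (negateOn K W) w ≡ - boundary W w
  boundary-negateOn-inside K closed W {w} K-w = trans (boundary-negateOn K closed W w) (cong (λ k → negIf k (boundary W w)) K-w)

  ∣boundary-negateOn∣ : ∀ K {es} → Closed es K → (W : All Weighted es) → ∀ w →
                        ∣ boundary (negateOn K W) w ∣ ≡ ∣ boundary W w ∣
  ∣boundary-negateOn∣ K closed W w = trans (cong ∣_∣ (boundary-negateOn K closed W w)) (∣negIf∣ (K w) (boundary W w))

  boundary-insert : ∀ pre {post x} (W : All Weighted (pre ++ post)) (h : Weighted x) w →
                    boundary (All-insert pre W h) w ≡ flowAt x (value h) w + boundary W w
  boundary-insert []                        W             h w = refl
  boundary-insert (e ∷ pre) {post} {x} (weighted y _ ∷ W) h w =
    trans (cong (λ i → flowAt e y w + i) (boundary-insert pre W h w)) (swap (flowAt e y w) (flowAt x (value h) w) (boundary W w))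
    where
    swap : ∀ i j k → i + (j + k) ≡ j + (i + k)
    swap = ℤ-Solver.solve-∀

  negateOn-∷-outside : ∀ K {e es} (h : Weighted e) (W : All Weighted es) → K (end₀ e) ≡ false →
                       negateOn K (h ∷ W) ≡ h ∷ negateOn K W
  negateOn-∷-outside K h W K-e = cong (λ k → negateIf k h ∷ negateOn K W) K-e

  -- Realising feasible demands

  Realisable : ℕ → Set
  Realisable k = ∀ es → length es ≡ k → ∀ D → EvenDegrees es → Feasible es D → Realisation es D

  off-toggled : ∀ {es D v} → ((W , ok) : Realisation es (toggle v D)) → ∀ {w} → v ≢ w → ∣ boundary W w ∣ ≡ demand (D w)
  off-toggled {D = D} (W , ok) {w} v≢w = trans (ok w) (cong demand (toggle-elsewhere D v≢w))

  extend-by-±2 : ∀ {a b τa τb rest D} s (V : All Weighted rest) → a ≢ b →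
                 ∣ twice s + boundary V a ∣ ≡ demand (D a) → ∣ twice ((s Sign.* τa) Sign.* τb) + boundary V b ∣ ≡ demand (D b) →
                 (∀ {w} → a ≢ w → b ≢ w → ∣ boundary V w ∣ ≡ demand (D w)) → Realisation (arc a b τa τb false ∷ rest) D
  extend-by-±2 {a} {b} {τa} {τb} {D = D} s V a≢b at-a at-b elsewhere =
    weighted (twice (s Sign.* τa)) (±2 (s Sign.* τa)) ∷ V , λ w →
      flowAt-realises (arc a b τa τb false) (twice (s Sign.* τa)) (boundary V) a≢b
        (λ a≡w → subst (λ v → ∣ twice (s Sign.* τa) * ⟦ τa ⟧ + boundary V v ∣ ≡ demand (D v)) a≡w
                       (trans (cong (λ z → ∣ z + boundary V a ∣) (twice-*-cancel s τa)) at-a))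
        (λ b≡w → subst (λ v → ∣ twice (s Sign.* τa) * ⟦ τb ⟧ + boundary V v ∣ ≡ demand (D v)) b≡w
                       (trans (cong (λ z → ∣ z + boundary V b ∣) (twice-* (s Sign.* τa) τb)) at-b))
        elsewhere

  -- Negating W on K flips the boundary at b but not at a.
  realise-across : ∀ {a b τa τb rest D} K → Closed rest K → K a ≡ false → K b ≡ true → a ≢ b → (W : All Weighted rest) →
                   ∣ boundary W a ∣ ≡ demand (not (D a)) → ∣ boundary W b ∣ ≡ demand (not (D b)) →
                   (∀ {w} → a ≢ w → b ≢ w → ∣ boundary W w ∣ ≡ demand (D w)) → Realisation (arc a b τa τb false ∷ rest) D
  realise-across {a} {b} {τa} {τb} {D = D} K closed-K K-a K-b a≢b W ∣W-a∣ ∣W-b∣ elsewhere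
    with absorb (D a) (boundary W a) ∣W-a∣
  ... | s , at-a with absorb-up-to-sign (D b) (boundary W b) ((s Sign.* τa) Sign.* τb) ∣W-b∣
  ...   | inj₁ at-b = extend-by-±2 s W a≢b at-a at-b elsewhere
  ...   | inj₂ at-b = extend-by-±2 s (negateOn K W) a≢b
          (subst (λ β → ∣ twice s + β ∣ ≡ demand (D a)) (sym (boundary-negateOn-outside K closed-K W K-a)) at-a)
          (subst (λ β → ∣ twice ((s Sign.* τa) Sign.* τb) + β ∣ ≡ demand (D b))
                 (sym (boundary-negateOn-inside K closed-K W K-b)) at-b)
          (λ a≢w b≢w → trans (∣boundary-negateOn∣ K closed-K W _) (elsewhere a≢w b≢w))

  realise-even : ∀ {k} → Realisable k → ∀ a b τa τb rest → length rest ≡ k → ∀ D →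
                 EvenDegrees (arc a b τa τb false ∷ rest) → Feasible (arc a b τa τb false ∷ rest) D →
                 Realisation (arc a b τa τb false ∷ rest) D
  realise-even ih a b τa τb rest len D even feasible with feasible? rest D
  ... | inj₁ feasible′ with ih rest len D even feasible′
  ...   | W , ok = weighted (+ 0) none ∷ W , λ w →
          trans (cong (λ z → ∣ z + boundary W w ∣) (cong₂ _+_ (at-0 a w) (at-0 b w)))
                (trans (cong ∣_∣ (ℤ.+-identityˡ (boundary W w))) (ok w))
  realise-even ih a b τa τb rest len D even feasible | inj₂ (X₀ , closed₀ , unbalanced₀) =
    crossing (ih rest len (toggle a (toggle b D)) even feasible′)
             (separator {X = X₀} {b} {a} closed₀ (trans (xor-comm (X₀ b) (X₀ a)) X₀-separates))
    where
    separates : ∀ Y → Closed rest Y → imbalance rest D Y ≡ (Y a xor Y b)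
    separates = imbalance-separating closed₀ unbalanced₀ (λ Y closed Ya≡Yb → feasible Y (Ya≡Yb ∷ closed))
    X₀-separates : X₀ a xor X₀ b ≡ true
    X₀-separates = trans (sym (separates X₀ closed₀)) unbalanced₀
    a≢b : a ≢ b
    a≢b a≡b with trans (sym (xor-same (X₀ a))) (trans (cong (λ v → X₀ a xor X₀ v) a≡b) X₀-separates)
    ... | ()
    feasible′ : Feasible rest (toggle a (toggle b D))
    feasible′ Y closed = begin
      imbalance rest (toggle a (toggle b D)) Y  ≡⟨ imbalance-toggle rest a (toggle b D) Y ⟩
      Y a xor imbalance rest (toggle b D) Y     ≡⟨ cong (Y a xor_) (imbalance-toggle rest b D Y) ⟩
      Y a xor (Y b xor imbalance rest D Y)      ≡⟨ cong (λ i → Y a xor (Y b xor i)) (separates Y closed) ⟩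
      Y a xor (Y b xor (Y a xor Y b))           ≡⟨ cancel (Y a) (Y b) ⟩
      false                                     ∎
      where
      open ≡-Reasoning
      cancel : ∀ p q → p xor (q xor (p xor q)) ≡ false
      cancel = solve-∀ xorRing
    crossing : Realisation rest (toggle a (toggle b D)) → Σ VertexSet (λ K → Closed rest K × K b ≡ true × K a ≡ false) →
               Realisation (arc a b τa τb false ∷ rest) D
    crossing (W , ok) (K , closed-K , K-b , K-a) =
      realise-across K closed-K K-a K-b a≢b W
        (trans (ok a) (cong demand (trans (toggle-here a (toggle b D))
                                         (cong not (toggle-elsewhere D (λ b≡a → a≢b (sym b≡a)))))))
        (trans (ok b) (cong demand (trans (toggle-elsewhere (toggle b D) a≢b) (toggle-here b D))))
        (λ {w} a≢w b≢w → trans (ok w) (cong demand (trans (toggle-elsewhere (toggle b D) a≢w) (toggle-elsewhere D b≢w))))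

  realise-loop : ∀ {k} → Realisable k → ∀ a τ₀ τ₁ rest → length rest ≡ k → ∀ D →
                 EvenDegrees (arc a a τ₀ τ₁ true ∷ rest) → Feasible (arc a a τ₀ τ₁ true ∷ rest) D →
                 Realisation (arc a a τ₀ τ₁ true ∷ rest) D
  realise-loop ih a τ₀ τ₁ rest len D even feasible = by-sign (sameSign τ₀ τ₁) refl
    where
    loop = arc a a τ₀ τ₁ true
    even′ : EvenDegrees rest
    even′ w = trans (cong (_xor xorOver (λ e → arcDegree e w) rest) (sym (xor-same (δ a w)))) (even w)
    feasible-with : ∀ {b} → sameSign τ₀ τ₁ ≡ b → ∀ Y → Closed rest Y →
                    parity (λ w → D w ∧ Y w) xor ((b ∧ Y a) xor xorOver (λ e → oddNegative e ∧ Y (end₀ e)) rest) ≡ false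
    feasible-with same Y closed =
      trans (cong (λ b → parity (λ w → D w ∧ Y w) xor ((b ∧ Y a) xor xorOver (λ e → oddNegative e ∧ Y (end₀ e)) rest)) (sym same))
            (feasible Y (refl ∷ closed))
    cancelling : sameSign τ₀ τ₁ ≡ false → Realisation rest D → Realisation (loop ∷ rest) D
    cancelling positive (W , ok) = weighted ⟦ Sign.+ ⟧ (±1 Sign.+) ∷ W , λ w →
      trans (cong (λ z → ∣ z + boundary W w ∣)
                  (trans (at-+ a _ _ w) (trans (cong (λ z → at a z w) (positive-loop τ₀ τ₁ positive)) (at-0 a w))))
            (trans (cong ∣_∣ (ℤ.+-identityˡ (boundary W w))) (ok w))
    doubling : sameSign τ₀ τ₁ ≡ true → Realisation rest (toggle a D) → Realisation (loop ∷ rest) D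
    doubling negative (W , ok) with absorb (D a) (boundary W a) (trans (ok a) (cong demand (toggle-here a D)))
    ... | s , at-a = weighted ⟦ s Sign.* τ₀ ⟧ (±1 (s Sign.* τ₀)) ∷ W , λ w →
      trans (cong (λ z → ∣ z + boundary W w ∣) (trans (at-+ a _ _ w) (cong (λ z → at a z w) (negative-loop s τ₀ τ₁ negative))))
            (at-realises a (twice s) (boundary W) (λ a≡w → subst (λ v → ∣ twice s + boundary W v ∣ ≡ demand (D v)) a≡w at-a)
                         (off-toggled (W , ok)))
    by-sign : ∀ b → sameSign τ₀ τ₁ ≡ b → Realisation (loop ∷ rest) D
    by-sign false positive = cancelling positive (ih rest len D even′ (feasible-with positive))
    by-sign true  negative = doubling negative (ih rest len (toggle a D) even′ feasible′)
      where
      feasible′ : Feasible rest (toggle a D)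
      feasible′ Y closed = trans (imbalance-toggle rest a D Y)
        (trans (xor-swap (Y a) (parity (λ w → D w ∧ Y w)) _) (feasible-with negative Y closed))

  -- Merging two odd arcs at a common end

  record SeenFrom (a : Fin n) (x : Arc) : Set where
    field
      far        : Fin n
      τnear τfar : Sign
      flow       : ∀ y w → flowAt x y w ≡ at a (y * ⟦ τnear ⟧) w + at far (y * ⟦ τfar ⟧) w
      closed     : ∀ (X : VertexSet) → X a ≡ X far → X (end₀ x) ≡ X (end₁ x)
      negative   : ∀ (X : VertexSet) → X a ≡ X far → oddNegative x ∧ X (end₀ x) ≡ (odd x ∧ sameSign τnear τfar) ∧ X a
      degree     : ∀ w → arcDegree x w ≡ odd x ∧ (δ a w xor δ far w)

  seenFrom₀ : ∀ x → SeenFrom (end₀ x) x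
  seenFrom₀ x = record
    { far = end₁ x ; τnear = τ₀ x ; τfar = τ₁ x
    ; flow = λ _ _ → refl ; closed = λ _ eq → eq ; negative = λ _ _ → refl ; degree = λ _ → refl }

  seenFrom₁ : ∀ x → SeenFrom (end₁ x) x
  seenFrom₁ x = record
    { far = end₀ x ; τnear = τ₁ x ; τfar = τ₀ x
    ; flow = λ y w → ℤ.+-comm (at (end₀ x) (y * ⟦ τ₀ x ⟧) w) (at (end₁ x) (y * ⟦ τ₁ x ⟧) w)
    ; closed = λ (X : VertexSet) eq → sym eq
    ; negative = λ (X : VertexSet) eq → cong₂ _∧_ (cong (odd x ∧_) (sameSign-comm (τ₀ x) (τ₁ x))) (sym eq)
    ; degree = λ w → cong (odd x ∧_) (xor-comm (δ (end₀ x) w) (δ (end₁ x) w)) }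

  record OddArcAt (a : Fin n) (es : List Arc) : Set where
    constructor oddArcAt
    field
      pre post : List Arc
      x        : Arc
      split    : es ≡ pre ++ x ∷ post
      odd-x    : odd x ≡ true
      seen     : SeenFrom a x

  findOddArcAt : ∀ a es → xorOver (λ e → arcDegree e a) es ≡ true → OddArcAt a es
  findOddArcAt a []       ()
  findOddArcAt a (x ∷ es) odd-degree = by-cases (odd x) refl (end₀ x ≟ a) (end₁ x ≟ a)
    where
    later : arcDegree x a ≡ false → OddArcAt a (x ∷ es)
    later even-x with findOddArcAt a es (trans (cong (_xor xorOver (λ e → arcDegree e a) es) (sym even-x)) odd-degree)
    ... | oddArcAt pre post y split odd-y seen = oddArcAt (x ∷ pre) post y (cong (x ∷_) split) odd-y seen
    by-cases : ∀ b → odd x ≡ b → Dec (end₀ x ≡ a) → Dec (end₁ x ≡ a) → OddArcAt a (x ∷ es)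
    by-cases false odd-x _ _ = later (cong (_∧ (δ (end₀ x) a xor δ (end₁ x) a)) odd-x)
    by-cases true odd-x (yes e₀≡a) _ = oddArcAt [] es x refl odd-x (subst (λ v → SeenFrom v x) e₀≡a (seenFrom₀ x))
    by-cases true odd-x (no _) (yes e₁≡a) = oddArcAt [] es x refl odd-x (subst (λ v → SeenFrom v x) e₁≡a (seenFrom₁ x))
    by-cases true odd-x (no n₀) (no n₁) =
      later (trans (cong₂ (λ p q → odd x ∧ (p xor q)) (dec-false (end₀ x ≟ a) n₀) (dec-false (end₁ x ≟ a) n₁)) (∧-zeroʳ (odd x)))

  module Merge {a b : Fin n} {p₁ q₁ : Sign} {pre post : List Arc} {x : Arc} (odd-x : odd x ≡ true) (V : SeenFrom a x) where
    open SeenFrom V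

    first : Arc
    first = arc a b p₁ q₁ true

    rest rest′ : List Arc
    rest  = pre ++ x ∷ post
    rest′ = pre ++ post

    merged : Sign → Arc
    merged ε = arc b far q₁ (ε Sign.* τfar) true

    cancelling doubling : Sign
    cancelling = Sign.opposite (p₁ Sign.* τnear)
    doubling   = p₁ Sign.* τnear

    even-merged : ∀ ε → EvenDegrees (first ∷ rest) → EvenDegrees (merged ε ∷ rest′)
    even-merged ε even w = begin
      (δ b w xor δ far w) xor R′                           ≡⟨ cancel (δ a w) (δ b w) (δ far w) R′ ⟨
      (δ a w xor δ b w) xor ((δ a w xor δ far w) xor R′)   ≡⟨ cong ((δ a w xor δ b w) xor_) rest-degree ⟨
      (δ a w xor δ b w) xor xorOver (λ e → arcDegree e w) rest ≡⟨ even w ⟩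
      false                                                 ∎
      where
      open ≡-Reasoning
      R′ = xorOver (λ e → arcDegree e w) rest′
      rest-degree : xorOver (λ e → arcDegree e w) rest ≡ (δ a w xor δ far w) xor R′
      rest-degree = trans (xorOver-mid (λ e → arcDegree e w) pre x post)
                          (cong (_xor R′) (trans (degree w) (cong (_∧ (δ a w xor δ far w)) odd-x)))
      cancel : ∀ p q r s → (p xor q) xor ((p xor r) xor s) ≡ (q xor r) xor s
      cancel = solve-∀ xorRing

    closed-merged : ∀ {ε ε′ Y} → Closed (merged ε ∷ rest′) Y → Closed (merged ε′ ∷ rest′) Y
    closed-merged (b~far ∷ closed′) = b~far ∷ closed′

    closed-unmerged : ∀ {ε Y} → Closed (merged ε ∷ rest′) Y → Y a ≡ Y b → Closed (first ∷ rest) Y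
    closed-unmerged {Y = Y} (b~far ∷ closed′) a~b = a~b ∷ All-insert pre closed′ (closed Y (trans a~b b~far))

    imbalance-merge : ∀ D Y → Y a ≡ Y b → Y b ≡ Y far → imbalance (first ∷ rest) D Y ≡ imbalance (merged cancelling ∷ rest′) D Y
    imbalance-merge D Y a~b b~far = begin
      P xor ((sameSign p₁ q₁ ∧ Y a) xor xorOver negY rest)
        ≡⟨ cong (λ r → P xor ((sameSign p₁ q₁ ∧ Y a) xor r)) rest-negatives ⟩
      P xor ((sameSign p₁ q₁ ∧ Y a) xor ((sameSign τnear τfar ∧ Y a) xor N′))
        ≡⟨ factor P (sameSign p₁ q₁) (sameSign τnear τfar) (Y a) N′ ⟩
      P xor (((sameSign p₁ q₁ xor sameSign τnear τfar) ∧ Y a) xor N′)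
        ≡⟨ cong₂ (λ s y → P xor ((s ∧ y) xor N′)) (sameSign-merge p₁ q₁ τnear τfar) (sym a~b) ⟨
      P xor ((sameSign q₁ (cancelling Sign.* τfar) ∧ Y b) xor N′) ∎
      where
      open ≡-Reasoning
      P = parity (λ w → D w ∧ Y w)
      negY : Arc → Bool
      negY e = oddNegative e ∧ Y (end₀ e)
      N′ = xorOver negY rest′
      rest-negatives : xorOver negY rest ≡ (sameSign τnear τfar ∧ Y a) xor N′
      rest-negatives = trans (xorOver-mid negY pre x post)
        (cong (_xor N′) (trans (negative Y (trans a~b b~far)) (cong (λ o → (o ∧ sameSign τnear τfar) ∧ Y a) odd-x)))
      factor : ∀ p s t y r → p xor ((s ∧ y) xor ((t ∧ y) xor r)) ≡ p xor (((s xor t) ∧ y) xor r)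
      factor = solve-∀ xorRing

    imbalance-doubling : ∀ D Y → imbalance (merged doubling ∷ rest′) (toggle a D) Y ≡
                                 imbalance (merged cancelling ∷ rest′) D Y xor (Y a xor Y b)
    imbalance-doubling D Y = begin
      imbalance (merged doubling ∷ rest′) (toggle a D) Y
        ≡⟨ imbalance-toggle (merged doubling ∷ rest′) a D Y ⟩
      Y a xor (P xor ((sameSign q₁ (doubling Sign.* τfar) ∧ Y b) xor N′))
        ≡⟨ flip (Y a) P (sameSign q₁ (doubling Sign.* τfar)) (Y b) N′ ⟩
      (P xor (((true xor sameSign q₁ (doubling Sign.* τfar)) ∧ Y b) xor N′)) xor (Y a xor Y b)
        ≡⟨ cong (λ s → (P xor ((s ∧ Y b) xor N′)) xor (Y a xor Y b))
                (trans (Bool.true-xor _) (sym (sameSign-opposite q₁ (p₁ Sign.* τnear) τfar))) ⟩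
      imbalance (merged cancelling ∷ rest′) D Y xor (Y a xor Y b) ∎
      where
      open ≡-Reasoning
      P = parity (λ w → D w ∧ Y w)
      N′ = xorOver (λ e → oddNegative e ∧ Y (end₀ e)) rest′
      flip : ∀ y p s z r → y xor (p xor ((s ∧ z) xor r)) ≡ (p xor (((true xor s) ∧ z) xor r)) xor (y xor z)
      flip = solve-∀ xorRing

    with-head : ∀ ε → Sign → All Weighted rest′ → All Weighted (merged ε ∷ rest′)
    with-head ε s W = weighted ⟦ s ⟧ (±1 s) ∷ W

    x-weighted : ∀ ε s → Weighted x
    x-weighted ε s = weighted ⟦ ε Sign.* s ⟧ (subst (λ o → Weight o ⟦ ε Sign.* s ⟧) (sym odd-x) (±1 (ε Sign.* s)))

    lift : ∀ ε → Sign → All Weighted rest′ → All Weighted (first ∷ rest)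
    lift ε s W = weighted ⟦ s ⟧ (±1 s) ∷ All-insert pre W (x-weighted ε s)

    boundary-lift : ∀ ε s W w → boundary (lift ε s W) w ≡
                    at a (⟦ s ⟧ * ⟦ p₁ ⟧ + ⟦ ε Sign.* s ⟧ * ⟦ τnear ⟧) w + boundary (with-head ε s W) w
    boundary-lift ε s W w = begin
      (A + B) + boundary (All-insert pre W (x-weighted ε s)) w
        ≡⟨ cong (λ i → (A + B) + i) (boundary-insert pre W (x-weighted ε s) w) ⟩
      (A + B) + (flowAt x ⟦ ε Sign.* s ⟧ w + boundary W w)
        ≡⟨ cong (λ f → (A + B) + (f + boundary W w)) (flow ⟦ ε Sign.* s ⟧ w) ⟩
      (A + B) + ((C + E) + boundary W w)
        ≡⟨ regroup A B C E (boundary W w) ⟩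
      (A + C) + ((B + E) + boundary W w)
        ≡⟨ cong₂ (λ i j → i + ((B + j) + boundary W w)) (at-+ a _ _ w) (cong (λ z → at far z w) (⟦⟧-shift ε s τfar)) ⟩
      at a (⟦ s ⟧ * ⟦ p₁ ⟧ + ⟦ ε Sign.* s ⟧ * ⟦ τnear ⟧) w + boundary (with-head ε s W) w ∎
      where
      open ≡-Reasoning
      A = at a (⟦ s ⟧ * ⟦ p₁ ⟧) w
      B = at b (⟦ s ⟧ * ⟦ q₁ ⟧) w
      C = at a (⟦ ε Sign.* s ⟧ * ⟦ τnear ⟧) w
      E = at far (⟦ ε Sign.* s ⟧ * ⟦ τfar ⟧) w
      regroup : ∀ i j k l m → (i + j) + ((k + l) + m) ≡ (i + k) + ((j + l) + m)
      regroup = ℤ-Solver.solve-∀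

    lift-cancelling : ∀ {D} → Realisation (merged cancelling ∷ rest′) D → Realisation (first ∷ rest) D
    lift-cancelling (weighted _ (±1 s) ∷ W , ok) = lift cancelling s W , λ w →
      trans (cong ∣_∣ (trans (boundary-lift cancelling s W w)
                             (trans (cong (λ z → at a z w + boundary (with-head cancelling s W) w) (merge-cancels s p₁ τnear))
                                    (trans (cong (_+ boundary (with-head cancelling s W) w) (at-0 a w))
                                           (ℤ.+-identityˡ (boundary (with-head cancelling s W) w))))))
            (ok w)

    lift-doubling : ∀ {D} s (W : All Weighted rest′) →
                    ∣ twice (s Sign.* p₁) + boundary (with-head doubling s W) a ∣ ≡ demand (D a) →
                    (∀ {w} → a ≢ w → ∣ boundary (with-head doubling s W) w ∣ ≡ demand (D w)) → Realisation (first ∷ rest) D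
    lift-doubling {D} s W at-a elsewhere = lift doubling s W , λ w →
      trans (cong ∣_∣ (trans (boundary-lift doubling s W w)
                             (cong (λ z → at a z w + boundary (with-head doubling s W) w) (merge-doubles s p₁ τnear))))
            (at-realises a (twice (s Sign.* p₁)) (boundary (with-head doubling s W))
              (λ a≡w → subst (λ v → ∣ twice (s Sign.* p₁) + boundary (with-head doubling s W) v ∣ ≡ demand (D v)) a≡w at-a)
              elsewhere)

    -- Negating the tail on K flips the boundary at a and leaves the head, whose end b lies outside K.
    lift-doubling-up-to-sign : ∀ {D} K → Closed (merged doubling ∷ rest′) K → K a ≡ true → K b ≡ false → ∀ s W →
                               (∀ w → ∣ boundary (with-head doubling s W) w ∣ ≡ demand (toggle a D w)) →
                               Realisation (first ∷ rest) D
    lift-doubling-up-to-sign {D} K closed-K K-a K-b s W ok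
      with absorb-up-to-sign (D a) (boundary (with-head doubling s W) a) (s Sign.* p₁) (trans (ok a) (cong demand (toggle-here a D)))
    ... | inj₁ at-a = lift-doubling s W at-a (off-toggled (with-head doubling s W , ok))
    ... | inj₂ at-a = lift-doubling s (negateOn K W)
          (subst (λ β → ∣ twice (s Sign.* p₁) + β ∣ ≡ demand (D a))
                 (sym (trans negated (boundary-negateOn-inside K closed-K (with-head doubling s W) K-a))) at-a)
          (λ {w} a≢w → trans (cong ∣_∣ negated)
                             (trans (∣boundary-negateOn∣ K closed-K (with-head doubling s W) w)
                                    (off-toggled (with-head doubling s W , ok) a≢w)))
      where
      negated : ∀ {w} → boundary (with-head doubling s (negateOn K W)) w ≡ boundary (negateOn K (with-head doubling s W)) w
      negated {w} = cong (λ V → boundary V w) (sym (negateOn-∷-outside K (weighted ⟦ s ⟧ (±1 s)) W K-b))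

    realise-doubling : ∀ {k D} → Realisable k → length rest ≡ k → EvenDegrees (first ∷ rest) → Feasible (first ∷ rest) D →
                       Unbalanced (merged cancelling ∷ rest′) D → Realisation (first ∷ rest) D
    realise-doubling {D = D} ih len even feasible (X₀ , closed₀ , unbalanced₀) =
      adding (ih (merged doubling ∷ rest′) (trans (sym (length-insert pre x post)) len) (toggle a D)
                 (even-merged doubling even) feasible⁺)
             (separator closed₀ X₀-separates)
      where
      separates : ∀ Y → Closed (merged cancelling ∷ rest′) Y → imbalance (merged cancelling ∷ rest′) D Y ≡ (Y a xor Y b)
      separates = imbalance-separating closed₀ unbalanced₀ λ where
        Y closed@(b~far ∷ _) a~b →
          trans (sym (imbalance-merge D Y a~b b~far)) (feasible Y (closed-unmerged {cancelling} closed a~b))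
      X₀-separates : X₀ a xor X₀ b ≡ true
      X₀-separates = trans (sym (separates X₀ closed₀)) unbalanced₀
      feasible⁺ : Feasible (merged doubling ∷ rest′) (toggle a D)
      feasible⁺ Y closed = begin
        imbalance (merged doubling ∷ rest′) (toggle a D) Y          ≡⟨ imbalance-doubling D Y ⟩
        imbalance (merged cancelling ∷ rest′) D Y xor (Y a xor Y b)
          ≡⟨ cong (_xor (Y a xor Y b)) (separates Y (closed-merged {doubling} {cancelling} closed)) ⟩
        (Y a xor Y b) xor (Y a xor Y b)                             ≡⟨ xor-same (Y a xor Y b) ⟩
        false                                                       ∎
        where open ≡-Reasoning
      adding : Realisation (merged doubling ∷ rest′) (toggle a D) →
               Σ VertexSet (λ K → Closed (merged cancelling ∷ rest′) K × K a ≡ true × K b ≡ false) → Realisation (first ∷ rest) D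
      adding (weighted _ (±1 s) ∷ W , ok) (K , closed-K , K-a , K-b) =
        lift-doubling-up-to-sign K (closed-merged {cancelling} {doubling} closed-K) K-a K-b s W ok

    realise-merging : ∀ {k D} → Realisable k → length rest ≡ k → EvenDegrees (first ∷ rest) → Feasible (first ∷ rest) D →
                   Realisation (first ∷ rest) D
    realise-merging {D = D} ih len even feasible with feasible? (merged cancelling ∷ rest′) D
    ... | inj₁ feasible⁻  = lift-cancelling (ih (merged cancelling ∷ rest′) (trans (sym (length-insert pre x post)) len) D
                                                     (even-merged cancelling even) feasible⁻)
    ... | inj₂ unbalanced = realise-doubling ih len even feasible unbalanced

  odd-arc-elsewhere : ∀ {a b p q rest} → a ≢ b → EvenDegrees (arc a b p q true ∷ rest) → xorOver (λ e → arcDegree e a) rest ≡ true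
  odd-arc-elsewhere {a} {b} {rest = rest} a≢b even =
    xor-true⇒≡true (trans (xor-comm R true) (trans ends (even a)))
    where
    R = xorOver (λ e → arcDegree e a) rest
    ends : true xor R ≡ (δ a a xor δ b a) xor R
    ends = sym (cong₂ (λ i j → (i xor j) xor R) (dec-true (a ≟ a) refl) (dec-false (b ≟ a) (λ b≡a → a≢b (sym b≡a))))

  realise : ∀ k → Realisable k
  realise zero    []                           _   D _    feasible = [] , λ w → sym (cong demand (feasible-[]⇒no-demand D feasible w))
  realise (suc k) (arc a b τa τb false ∷ rest) len                = realise-even (realise k) a b τa τb rest (ℕ.suc-injective len)
  realise (suc k) (arc a b p q true ∷ rest)    len D even feasible with a ≟ b
  ... | yes refl = realise-loop (realise k) a p q rest (ℕ.suc-injective len) D even feasible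
  ... | no a≢b with findOddArcAt a rest (odd-arc-elsewhere {p = p} {q} {rest} a≢b even)
  ...   | oddArcAt pre post x refl odd-x seen = Merge.realise-merging odd-x seen (realise k) (ℕ.suc-injective len) even feasible

-- From signed graphs to arc systems

inSupport : ℤ → Bool
inSupport z = not (does (z ℤ.≟ + 0))

inSupport⇔ : ∀ z → (¬ z ≡ + 0) ⇔ inSupport z ≡ true
inSupport⇔ z = mk⇔ from to
  where
  to : inSupport z ≡ true → ¬ z ≡ + 0
  to supp z≡0 with trans (sym supp) (cong not (dec-true (z ℤ.≟ + 0) z≡0))
  ... | ()
  from : ¬ z ≡ + 0 → inSupport z ≡ true
  from z≢0 = cong not (dec-false (z ℤ.≟ + 0) z≢0)

Weight-odd⇔ : ∀ {b y} → Weight b y → b ≡ true ⇔ ∣ y ∣ ≡ 1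
Weight-odd⇔ (±1 Sign.+) = mk⇔ (λ _ → refl) (λ _ → refl)
Weight-odd⇔ (±1 Sign.-) = mk⇔ (λ _ → refl) (λ _ → refl)
Weight-odd⇔ none        = mk⇔ (λ ()) (λ ())
Weight-odd⇔ (±2 Sign.+) = mk⇔ (λ ()) (λ ())
Weight-odd⇔ (±2 Sign.-) = mk⇔ (λ ()) (λ ())

Weight-bound : ∀ {b y} → Weight b y → ∣ y ∣ ℕ.< 3
Weight-bound (±1 Sign.+) = ℕ.s≤s (ℕ.s≤s ℕ.z≤n)
Weight-bound (±1 Sign.-) = ℕ.s≤s (ℕ.s≤s ℕ.z≤n)
Weight-bound none        = ℕ.s≤s ℕ.z≤n
Weight-bound (±2 Sign.+) = ℕ.s≤s (ℕ.s≤s (ℕ.s≤s ℕ.z≤n))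
Weight-bound (±2 Sign.-) = ℕ.s≤s (ℕ.s≤s (ℕ.s≤s ℕ.z≤n))

isMinus : Sign → Bool
isMinus Sign.- = true
isMinus Sign.+ = false

sameSign-orientation : ∀ t₀ t₁ s → t₀ Sign.* t₁ ≡ Sign.opposite s → sameSign t₀ t₁ ≡ isMinus s
sameSign-orientation Sign.+ Sign.+ Sign.- _ = refl
sameSign-orientation Sign.+ Sign.- Sign.+ _ = refl
sameSign-orientation Sign.- Sign.+ Sign.+ _ = refl
sameSign-orientation Sign.- Sign.- Sign.- _ = refl

∑ℤ-cong : ∀ k {F G : Fin k → ℤ} → F ≗ G → ∑ℤ k F ≡ ∑ℤ k G
∑ℤ-cong zero    F≗G = refl
∑ℤ-cong (suc k) F≗G = cong₂ _+_ (F≗G zero) (∑ℤ-cong k (λ i → F≗G (suc i)))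

∑ℕ-cong : ∀ k {F G : Fin k → ℕ} → F ≗ G → ∑ℕ k F ≡ ∑ℕ k G
∑ℕ-cong zero    F≗G = refl
∑ℕ-cong (suc k) F≗G = cong₂ ℕ._+_ (F≗G zero) (∑ℕ-cong k (λ i → F≗G (suc i)))

-- negInSupp sums an indicator local to its where block; this names it.
negInSupp-as-sum : ∀ G (f : Edge G → ℤ) → Σ (Edge G → ℕ) λ g → negInSupp G f ≡ ∑ℕ (m G) g
negInSupp-as-sum G f = _ , refl

negInSupp-indicator : ∀ G f e → proj₁ (negInSupp-as-sum G f) e ≡ bit (inSupport (f e) ∧ isMinus (σ G e))
negInSupp-indicator G f e with f e ℤ.≟ + 0 | σ G e
... | yes _ | Sign.+ = refl
... | yes _ | Sign.- = refl
... | no _  | Sign.+ = refl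
... | no _  | Sign.- = refl

HasParity : ℤ → Bool → Set
HasParity x b = Σ ℤ λ q → x ≡ + bit b + q * + 2

HasParity-+ : ∀ {x y a b} → HasParity x a → HasParity y b → HasParity (x + y) (a xor b)
HasParity-+ {x} {y} {a} {b} (q , x≡) (r , y≡) = bit-∧ + (q + r) , (begin
  x + y                                                ≡⟨ cong₂ _+_ x≡ y≡ ⟩
  (+ bit a + q * + 2) + (+ bit b + r * + 2)            ≡⟨ regroup (+ bit a) (+ bit b) q r ⟩
  (+ bit a + + bit b) + (q + r) * + 2                  ≡⟨ cong (_+ (q + r) * + 2) (bits a b) ⟩
  (+ bit (a xor b) + bit-∧ * + 2) + (q + r) * + 2      ≡⟨ collect (+ bit (a xor b)) bit-∧ (q + r) ⟩
  + bit (a xor b) + (bit-∧ + (q + r)) * + 2            ∎)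
  where
  open ≡-Reasoning
  bit-∧ = + bit (a ∧ b)
  bits : ∀ a b → + bit a + + bit b ≡ + bit (a xor b) + + bit (a ∧ b) * + 2
  bits false false = refl
  bits false true  = refl
  bits true  false = refl
  bits true  true  = refl
  regroup : ∀ i j q r → (i + q * + 2) + (j + r * + 2) ≡ (i + j) + (q + r) * + 2
  regroup = ℤ-Solver.solve-∀
  collect : ∀ i c s → (i + c * + 2) + s * + 2 ≡ i + (c + s) * + 2
  collect = ℤ-Solver.solve-∀

HasParity-∑ : ∀ k {F : Fin k → ℤ} {t : Fin k → Bool} → (∀ i → HasParity (F i) (t i)) → HasParity (∑ℤ k F) (parity t)
HasParity-∑ zero    _   = + 0 , refl
HasParity-∑ (suc k) F≡t = HasParity-+ (F≡t zero) (HasParity-∑ k (λ i → F≡t (suc i)))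

odd⇒∤2 : ∀ {x} → HasParity x true → ¬ (+ 2 ℤ∣ᵘ.∣ x)
odd⇒∤2 {x} (q , x≡) 2∣x with ℕ∣.∣1⇒≡1 (ℤ∣.∣⇒∣ᵤ 2∣1)
  where
  2∣1 : + 2 ℤ∣.∣ + 1
  2∣1 = ℤ∣.∣m+n∣n⇒∣m {m = + 1} {n = q * + 2} (subst (+ 2 ℤ∣.∣_) x≡ (ℤ∣.∣ᵤ⇒∣ 2∣x)) (ℤ∣.divides q refl)
... | ()

module FromGraph (G : SignedGraph) (O : Orientation G) (f₁ : Edge G → ℤ) where
  open Arcs (n G)

  arcOf : Edge G → Arc
  arcOf e = arc (end G e zero) (end G e (suc zero)) (τ O e zero) (τ O e (suc zero)) (inSupport (f₁ e))

  arcs : List Arc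
  arcs = tabulate arcOf

  ∂≡∑flowAt : ∀ (f : Edge G → ℤ) w → ∂ G O f w ≡ ∑ℤ (m G) (λ e → flowAt (arcOf e) (f e) w)
  ∂≡∑flowAt f w = ∑ℤ-cong (m G) λ e →
    trans (cong₂ _+_ (half e zero) (trans (cong (_+ + 0) (half e (suc zero))) (ℤ.+-identityʳ _))) refl
    where
    half : ∀ e s → halfContribution G O f w e s ≡ at (end G e s) (f e * ⟦ τ O e s ⟧) w
    half e s with end G e s ≟ w
    ... | yes _ = refl
    ... | no  _ = refl

  boundary-tabulate : ∀ {k} (g : Fin k → Arc) (W : All Weighted (tabulate g)) w →
                      boundary W w ≡ ∑ℤ k (λ i → flowAt (g i) (value (tabulate⁻ W i)) w)
  boundary-tabulate {zero}  g []      w = refl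
  boundary-tabulate {suc k} g (h ∷ W) w = cong (λ i → flowAt (g zero) (value h) w + i) (boundary-tabulate (λ i → g (suc i)) W w)

  even-degrees : (∀ e → ∣ f₁ e ∣ ℕ.< 2) → (∀ w → + 2 ℤ∣ᵘ.∣ ∂ G O f₁ w) → EvenDegrees arcs
  even-degrees bounded modulo w with xorOver (λ e → arcDegree e w) arcs in degree
  ... | false = refl
  ... | true  = ⊥-elim (odd⇒∤2 (subst (HasParity (∂ G O f₁ w)) degree ∂-parity) (modulo w))
    where
    unit-parity : ∀ y t → ∣ y ∣ ℕ.< 2 → HasParity (y * ⟦ t ⟧) (inSupport y)
    unit-parity (+ 0)             t      _ = + 0 , refl
    unit-parity (+ 1)             Sign.+ _ = + 0 , refl
    unit-parity (+ 1)             Sign.- _ = -[1+ 0 ] , refl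
    unit-parity -[1+ 0 ]          Sign.+ _ = -[1+ 0 ] , refl
    unit-parity -[1+ 0 ]          Sign.- _ = + 0 , refl
    unit-parity (+ suc (suc _))   t      (ℕ.s≤s (ℕ.s≤s ()))
    unit-parity -[1+ suc _ ]      t      (ℕ.s≤s (ℕ.s≤s ()))
    at-parity : ∀ v y t → ∣ y ∣ ℕ.< 2 → HasParity (at v (y * ⟦ t ⟧) w) (δ v w ∧ inSupport y)
    at-parity v y t bound = by-cases (δ v w)
      where
      by-cases : ∀ b → HasParity (if b then y * ⟦ t ⟧ else + 0) (b ∧ inSupport y)
      by-cases false = + 0 , refl
      by-cases true  = unit-parity y t bound
    arc-parity : ∀ e → HasParity (flowAt (arcOf e) (f₁ e) w) (arcDegree (arcOf e) w)
    arc-parity e = subst (HasParity (flowAt (arcOf e) (f₁ e) w))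
                         (factor (δ (end G e zero) w) (δ (end G e (suc zero)) w) (inSupport (f₁ e)))
      (HasParity-+ (at-parity (end G e zero) (f₁ e) (τ O e zero) (bounded e))
                   (at-parity (end G e (suc zero)) (f₁ e) (τ O e (suc zero)) (bounded e)))
      where
      factor : ∀ p q s → (p ∧ s) xor (q ∧ s) ≡ s ∧ (p xor q)
      factor = solve-∀ xorRing
    ∂-parity : HasParity (∂ G O f₁ w) (xorOver (λ e → arcDegree e w) arcs)
    ∂-parity = subst₂ HasParity (sym (∂≡∑flowAt f₁ w)) (sym (xorOver-tabulate (λ e → arcDegree e w) arcOf))
                      (HasParity-∑ (m G) arc-parity)

  negatives-even : 2 ∣ negInSupp G f₁ → parity (λ e → oddNegative (arcOf e)) ≡ false
  negatives-even even = even-count⇒parity-false (m G) (λ e → oddNegative (arcOf e)) (subst (2 ∣_) count≡ even)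
    where
    count≡ : negInSupp G f₁ ≡ ∑ℕ (m G) (λ e → bit (oddNegative (arcOf e)))
    count≡ = trans (proj₂ (negInSupp-as-sum G f₁)) (∑ℕ-cong (m G) λ e →
      trans (negInSupp-indicator G f₁ e)
            (cong (λ s → bit (inSupport (f₁ e) ∧ s)) (sym (sameSign-orientation _ _ (σ G e) (τ-prop O e)))))

  feasible-arcs : Connected G → 2 ∣ negInSupp G f₁ → Feasible arcs (λ _ → false)
  feasible-arcs connected even X closed = begin
    imbalance arcs (λ _ → false) X
      ≡⟨ cong (_xor xorOver (λ e → oddNegative e ∧ X (end₀ e)) arcs) (sum-replicate-zero (n G)) ⟩
    xorOver (λ e → oddNegative e ∧ X (end₀ e)) arcs
      ≡⟨ xorOver-tabulate (λ e → oddNegative e ∧ X (end₀ e)) arcOf ⟩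
    parity (λ e → oddNegative (arcOf e) ∧ X (end G e zero))
      ≡⟨ sum-cong-≗ (λ e → ∧-comm (oddNegative (arcOf e)) (X (end G e zero))) ⟩
    parity (λ e → X (end G e zero) ∧ oddNegative (arcOf e))
      ≡⟨ parity-∧-constant _ _ (λ i j → reach-constant (connected (end G i zero) (end G j zero))) (negatives-even even) ⟩
    false ∎
    where
    open ≡-Reasoning
    reach-constant : ∀ {u v} → Reach G u v → X u ≡ X v
    reach-constant here                     = refl
    reach-constant (step e zero r refl)       = trans (reach-constant r) (tabulate⁻ closed e)
    reach-constant (step e (suc zero) r refl) = trans (reach-constant r) (sym (tabulate⁻ closed e))

  integer-flow : Realisation arcs (λ _ → false) →
                 Σ (Edge G → ℤ) λ f₂ → IntegerFlow G O 3 f₂ × (∀ e → InSupp {G} f₁ e ⇔ (∣ f₂ e ∣ ≡ 1))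
  integer-flow (W , ok) = f₂ , ((λ e → Weight-bound (weight (tabulate⁻ W e))) , conserved) , support
    where
    f₂ : Edge G → ℤ
    f₂ e = value (tabulate⁻ W e)
    conserved : ∀ v → ∂ G O f₂ v ≡ + 0
    conserved v = trans (∂≡∑flowAt f₂ v) (trans (sym (boundary-tabulate arcOf W v)) (ℤ.∣i∣≡0⇒i≡0 (ok v)))
    support : ∀ e → InSupp {G} f₁ e ⇔ (∣ f₂ e ∣ ≡ 1)
    support e = ⇔.trans (inSupport⇔ (f₁ e)) (Weight-odd⇔ (weight (tabulate⁻ W e)))

theorem1p4 : (G : SignedGraph) → (O : Orientation G) → Connected G →
    (f₁ : Edge G → ℤ) → ModuloFlow G O 2 f₁ → 2 ∣ negInSupp G f₁ →
    Σ (Edge G → ℤ) (λ f₂ → IntegerFlow G O 3 f₂ ×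
      (∀ e → InSupp {G} f₁ e ⇔ (∣ f₂ e ∣ ≡ 1)))
theorem1p4 G O connected f₁ (bounded , modulo) even-negatives =
  integer-flow (realise (m G) arcs (length-tabulate arcOf) (λ _ → false)
                        (even-degrees bounded modulo) (feasible-arcs connected even-negatives))
  where
  open Arcs (n G)
  open FromGraph G O f₁
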